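{- There is a 1-factorization $\mathcal{M}$ of the hypercube $Q_4$ such that $G[\mathcal{M}]$ is isomorphic to the complete bipartite graph $K_{3,1}$.
   Context: The hypercube $Q_4$ has as vertices the subsets of $\{1,2,3,4\}$, two vertices being adjacent if they differ in exactly one element. A 1-factorization of a graph $H$ is a partition of its edge set into perfect matchings. For a 1-factorization $\mathcal{M}=\{M_1,\ldots,M_m\}$ of $H$, $G[\mathcal{M}]$ is the graph with vertex set $\{M_1,\ldots,M_m\}$ in which $M_i$ and $M_j$ ($i\ne j$) are adjacent if and only if $M_i\cup M_j$ is a Hamilton cycle of $H$. -}

module Defs where

open import Level using (0ℓ)
open import Data.Nat using (ℕ; suc)
open import Data.Nat.DivMod using (_%_; m%n<n)
open import Data.Fin using (Fin; toℕ; fromℕ<)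
open import Data.Fin.Subset using (Subset; _─_; _∪_; ∣_∣)
open import Data.Product using (Σ; ∃; ∃!; _×_; _,_)
open import Data.Sum using (_⊎_; inj₁; inj₂)
open import Data.Empty using (⊥)
open import Data.Unit using (⊤)
open import Function.Definitions using (Injective)
open import Relation.Binary.Core using (Rel)
open import Relation.Binary.PropositionalEquality using (_≡_; _≢_)
open import Function.Bundles using (_⇔_)

V : Set
V = Subset 4

Q4Adj : Rel V 0ℓ
Q4Adj u v = ∣ (u ─ v) ∪ (v ─ u) ∣ ≡ 1

Subgraph : Set₁
Subgraph = Rel V 0ℓ

IsPerfectMatching : Subgraph → Set
IsPerfectMatching M =
  (∀ u v → M u v → M v u) ×
  (∀ u v → M u v → Q4Adj u v) ×
  (∀ u → ∃! _≡_ (M u))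

-- 1-factorization of Q₄, indexed by Fin m: every part is a perfect matching
-- and every edge of Q₄ lies in exactly one part (partition of the edge set;
-- parts are nonempty, hence pairwise distinct, since they are perfect matchings).
IsOneFactorization : ∀ {m} → (Fin m → Subgraph) → Set
IsOneFactorization {m} M =
  (∀ i → IsPerfectMatching (M i)) ×
  (∀ u v → Q4Adj u v → ∃! _≡_ (λ i → M i u v))

next : Fin 16 → Fin 16
next k = fromℕ< (m%n<n (suc (toℕ k)) 16)

-- The edge relation F is (the edge set of) a Hamilton cycle of Q₄:
-- its edges are edges of Q₄ and there is a cyclic ordering c of all
-- 16 vertices (injective, hence bijective) such that F u v holds iff
-- {u,v} = {c k, c (k+1 mod 16)} for some k.
IsHamiltonCycle : Subgraph → Set
IsHamiltonCycle F =
  (∀ u v → F u v → Q4Adj u v) ×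
  Σ (Fin 16 → V) λ c → Injective _≡_ _≡_ c ×
    (∀ u v → F u v ⇔ (∃ λ k → (c k ≡ u × c (next k) ≡ v) ⊎ (c k ≡ v × c (next k) ≡ u)))

GAdj : ∀ {m} → (Fin m → Subgraph) → Fin m → Fin m → Set
GAdj M i j = i ≢ j × IsHamiltonCycle (λ u v → M i u v ⊎ M j u v)

K31 : Set
K31 = Fin 3 ⊎ Fin 1

K31Adj : K31 → K31 → Set
K31Adj (inj₁ _) (inj₂ _) = ⊤
K31Adj (inj₂ _) (inj₁ _) = ⊤
K31Adj _ _ = ⊥

-- Each matching Mᵢ is given by assigning to every vertex u the coordinate
-- direction of its Mᵢ-edge, so Mᵢ pairs u with u flipped in that coordinate
-- and every edge of Mᵢ is automatically an edge of Q₄.  All remaining facts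
-- are finite and are settled by evaluating decision procedures:
--   * the partner maps are involutions that disagree everywhere and together
--     cover every edge, which gives a 1-factorization;
--   * for j ≠ 0, the walk from the empty set alternating between M₀ and Mⱼ
--     traces the edge set of M₀ ∪ Mⱼ as a cyclic sequence of 16 distinct
--     vertices, i.e. a Hamilton cycle;
--   * for distinct i, j ≠ 0, the vertices of the Mᵢ/Mⱼ-alternating cycle
--     through the empty set form a proper vertex set closed under both
--     matchings; since a Hamilton cycle is connected, Mᵢ ∪ Mⱼ is not one.
module Submission where

open import Defs
open import Data.Bool using (Bool; true; false; not)
open import Data.Bool.Properties using () renaming (_≟_ to _≟ᵇ_)
open import Data.Fin using (Fin; zero; suc; #_; toℕ; inject₁)
open import Data.Fin.Induction using (<-weakInduction)
open import Data.Fin.Properties using (all?; any?) renaming (_≟_ to _≟ᶠ_)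
open import Data.Fin.Subset using (Subset; _─_; _∪_; ∣_∣)
open import Data.Fin.Subset.Properties using (anySubset?)
open import Data.Nat using (ℕ; zero; suc; _≟_)
open import Data.Product using (Σ; ∃; ∃!; _×_; _,_; proj₁; proj₂)
open import Data.Sum using (_⊎_; inj₁; inj₂; swap)
open import Data.Unit using (tt)
open import Data.Vec using (Vec; []; _∷_; lookup; _[_]%=_)
open import Data.Vec.Properties using (≡-dec)
open import Function.Base using (_∘_; const)
open import Function.Bundles using (_⤖_; _⇔_; Bijection; Equivalence; mk⇔; mk↔ₛ′)
open import Function.Definitions using (Injective)
open import Function.Properties.Inverse using (↔⇒⤖)
open import Relation.Binary using () renaming (Decidable to Decidable₂)
open import Relation.Binary.PropositionalEquality using (_≡_; _≢_; refl; sym; trans; cong; subst)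
open import Relation.Nullary using (¬_; Dec; yes; no; does; ¬?; _×-dec_; _⊎-dec_; _→-dec_)
open import Relation.Nullary.Decidable using (from-yes; map′; decidable-stable)
open import Relation.Unary using (Pred; Decidable)

allSubset? : ∀ {n p} {P : Pred (Subset n) p} → Decidable P → Dec (∀ u → P u)
allSubset? P? = map′ (λ ¬∃¬ u → decidable-stable (P? u) (λ ¬Pu → ¬∃¬ (u , ¬Pu)))
                     (λ ∀P (u , ¬Pu) → ¬Pu (∀P u))
                     (¬? (anySubset? (¬? ∘ P?)))

_⇔-dec_ : ∀ {A B : Set} → Dec A → Dec B → Dec (A ⇔ B)
a? ⇔-dec b? = map′ (λ (f , g) → mk⇔ f g) (λ e → Equivalence.to e , Equivalence.from e)
                   ((a? →-dec b?) ×-dec (b? →-dec a?))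

_≟ᵛ_ : (u v : V) → Dec (u ≡ v)
_≟ᵛ_ = ≡-dec _≟ᵇ_

symDiff : ∀ {n} → Subset n → Subset n → Subset n
symDiff u v = (u ─ v) ∪ (v ─ u)

∣symDiff-self∣ : ∀ {n} (u : Subset n) → ∣ symDiff u u ∣ ≡ 0
∣symDiff-self∣ [] = refl
∣symDiff-self∣ (false ∷ u) = ∣symDiff-self∣ u
∣symDiff-self∣ (true ∷ u) = ∣symDiff-self∣ u

∣symDiff-flip∣ : ∀ {n} (d : Fin n) (u : Subset n) → ∣ symDiff u (u [ d ]%= not) ∣ ≡ 1
∣symDiff-flip∣ zero (false ∷ u) = cong suc (∣symDiff-self∣ u)
∣symDiff-flip∣ zero (true ∷ u) = cong suc (∣symDiff-self∣ u)
∣symDiff-flip∣ (suc d) (false ∷ u) = ∣symDiff-flip∣ d u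
∣symDiff-flip∣ (suc d) (true ∷ u) = ∣symDiff-flip∣ d u

involutions-factorize : ∀ {m} (p : Fin m → V → V) →
  (∀ i u → p i (p i u) ≡ u) → (∀ i u → Q4Adj u (p i u)) →
  (∀ u i j → p i u ≡ p j u → i ≡ j) → (∀ u v → Q4Adj u v → ∃ λ i → p i u ≡ v) →
  IsOneFactorization (λ i u v → p i u ≡ v)
involutions-factorize p involutive adjacent distinct covering = perfect , unique-part
  where
  perfect : ∀ i → IsPerfectMatching (λ u v → p i u ≡ v)
  perfect i = (λ { u _ refl → involutive i u })
            , (λ { u _ refl → adjacent i u })
            , (λ u → p i u , refl , λ e → e)
  unique-part : ∀ u v → Q4Adj u v → ∃! _≡_ (λ i → p i u ≡ v)
  unique-part u v uv with covering u v uv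
  ... | i , refl = i , refl , λ {j} e → distinct u i j (sym e)

pattern O = false
pattern I = true
pattern ⟨_,_,_,_⟩ a b c d = a ∷ b ∷ c ∷ d ∷ []

-- Row u lists the directions of the edges of M₀, M₁, M₂, M₃ at the vertex u.
directions : V → Vec (Fin 4) 4
directions ⟨ O , O , O , O ⟩ = # 0 ∷ # 1 ∷ # 2 ∷ # 3 ∷ []
directions ⟨ I , O , O , O ⟩ = # 0 ∷ # 1 ∷ # 2 ∷ # 3 ∷ []
directions ⟨ O , I , O , O ⟩ = # 2 ∷ # 1 ∷ # 3 ∷ # 0 ∷ []
directions ⟨ I , I , O , O ⟩ = # 3 ∷ # 1 ∷ # 2 ∷ # 0 ∷ []
directions ⟨ O , O , I , O ⟩ = # 3 ∷ # 0 ∷ # 2 ∷ # 1 ∷ []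
directions ⟨ I , O , I , O ⟩ = # 1 ∷ # 0 ∷ # 2 ∷ # 3 ∷ []
directions ⟨ O , I , I , O ⟩ = # 2 ∷ # 0 ∷ # 3 ∷ # 1 ∷ []
directions ⟨ I , I , I , O ⟩ = # 1 ∷ # 0 ∷ # 2 ∷ # 3 ∷ []
directions ⟨ O , O , O , I ⟩ = # 1 ∷ # 0 ∷ # 2 ∷ # 3 ∷ []
directions ⟨ I , O , O , I ⟩ = # 2 ∷ # 0 ∷ # 1 ∷ # 3 ∷ []
directions ⟨ O , I , O , I ⟩ = # 1 ∷ # 2 ∷ # 3 ∷ # 0 ∷ []
directions ⟨ I , I , O , I ⟩ = # 3 ∷ # 2 ∷ # 1 ∷ # 0 ∷ []
directions ⟨ O , O , I , I ⟩ = # 3 ∷ # 0 ∷ # 2 ∷ # 1 ∷ []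
directions ⟨ I , O , I , I ⟩ = # 2 ∷ # 0 ∷ # 1 ∷ # 3 ∷ []
directions ⟨ O , I , I , I ⟩ = # 0 ∷ # 2 ∷ # 3 ∷ # 1 ∷ []
directions ⟨ I , I , I , I ⟩ = # 0 ∷ # 2 ∷ # 1 ∷ # 3 ∷ []

partner : Fin 4 → V → V
partner i u = u [ lookup (directions u) i ]%= not

M : Fin 4 → Subgraph
M i u v = partner i u ≡ v

M-factorization : IsOneFactorization M
M-factorization = involutions-factorize partner
  (from-yes (all? λ i → allSubset? λ u → partner i (partner i u) ≟ᵛ u))
  (λ i u → ∣symDiff-flip∣ (lookup (directions u) i) u)
  (from-yes (allSubset? λ u → all? λ i → all? λ j → (partner i u ≟ᵛ partner j u) →-dec (i ≟ᶠ j)))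
  (from-yes (allSubset? λ u → allSubset? λ v → (∣ symDiff u v ∣ ≟ 1) →-dec any? λ i → partner i u ≟ᵛ v))

Union : Fin 4 → Fin 4 → Subgraph
Union i j u v = M i u v ⊎ M j u v

union? : ∀ i j → Decidable₂ (Union i j)
union? i j u v = (partner i u ≟ᵛ v) ⊎-dec (partner j u ≟ᵛ v)

Consecutive : (Fin 16 → V) → Subgraph
Consecutive c u v = ∃ λ k → (c k ≡ u × c (next k) ≡ v) ⊎ (c k ≡ v × c (next k) ≡ u)

consecutive? : ∀ c → Decidable₂ (Consecutive c)
consecutive? c u v = any? λ k → ((c k ≟ᵛ u) ×-dec (c (next k) ≟ᵛ v))
                           ⊎-dec ((c k ≟ᵛ v) ×-dec (c (next k) ≟ᵛ u))

Traces : Subgraph → (Fin 16 → V) → Set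
Traces F c = Injective _≡_ _≡_ c × (∀ u v → F u v ⇔ Consecutive c u v)

traces? : ∀ {F} → Decidable₂ F → ∀ c → Dec (Traces F c)
traces? F? c = injective? ×-dec allSubset? λ u → allSubset? λ v → F? u v ⇔-dec consecutive? c u v
  where
  injective? : Dec (Injective _≡_ _≡_ c)
  injective? = map′ (λ inj {k} {l} → inj k l) (λ inj k l → inj)
                    (all? λ k → all? λ l → (c k ≟ᵛ c l) →-dec (k ≟ᶠ l))

hamiltonian-resp : ∀ {F G} → (∀ u v → F u v ⇔ G u v) → IsHamiltonCycle F → IsHamiltonCycle G
hamiltonian-resp F⇔G (edges , c , inj , traced) =
    (λ u v → edges u v ∘ Equivalence.from (F⇔G u v))
  , c , inj
  , λ u v → mk⇔ (Equivalence.to (traced u v) ∘ Equivalence.from (F⇔G u v))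
                (Equivalence.to (F⇔G u v) ∘ Equivalence.from (traced u v))

next-inject₁ : ∀ (k : Fin 15) → next (inject₁ k) ≡ suc k
next-inject₁ = from-yes (all? λ k → next (inject₁ k) ≟ᶠ suc k)

-- A Hamilton cycle is connected: a colouring S that is constant along the
-- edges of F takes the same value on any two vertices having an F-neighbour.
hamiltonian-connected : ∀ {F} → IsHamiltonCycle F → (S : V → Bool) →
  (∀ u v → F u v → S u ≡ S v) → ∀ {a a′ b b′} → F a a′ → F b b′ → S a ≡ S b
hamiltonian-connected {F} (_ , c , _ , traced) S respects Faa′ Fbb′ =
  trans (on-cycle Faa′) (sym (on-cycle Fbb′))
  where
  step : ∀ k → S (c k) ≡ S (c (next k))
  step k = respects _ _ (Equivalence.from (traced _ _) (k , inj₁ (refl , refl)))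
  constant : ∀ k → S (c k) ≡ S (c zero)
  constant = <-weakInduction (λ k → S (c k) ≡ S (c zero)) refl λ k same →
    subst (λ l → S (c l) ≡ S (c zero)) (next-inject₁ k) (trans (sym (step (inject₁ k))) same)
  on-cycle : ∀ {u v} → F u v → S u ≡ S (c zero)
  on-cycle Fuv with Equivalence.to (traced _ _) Fuv
  ... | k , inj₁ (refl , _) = constant k
  ... | k , inj₂ (_ , refl) = constant (next k)

Splits : Fin 4 → Fin 4 → (V → Bool) → Set
Splits i j S = (∀ u → S (partner i u) ≡ S u) × (∀ u → S (partner j u) ≡ S u) ×
               (∃ λ a → S a ≡ true) × (∃ λ b → S b ≡ false)

split-union-not-hamiltonian : ∀ i j (S : V → Bool) → Splits i j S → ¬ IsHamiltonCycle (Union i j)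
split-union-not-hamiltonian i j S (closedᵢ , closedⱼ , (_ , Sa) , (_ , Sb)) hamiltonian =
  true≢false (trans (sym Sa) (trans (connected (inj₁ refl) (inj₁ refl)) Sb))
  where
  true≢false : true ≢ false
  true≢false ()
  respects : ∀ u v → Union i j u v → S u ≡ S v
  respects u _ (inj₁ refl) = sym (closedᵢ u)
  respects u _ (inj₂ refl) = sym (closedⱼ u)
  connected : ∀ {a a′ b b′} → Union i j a a′ → Union i j b b′ → S a ≡ S b
  connected = hamiltonian-connected hamiltonian S respects

alternatingWalk : (V → V) → (V → V) → V → ℕ → V
alternatingWalk p q a zero = a
alternatingWalk p q a (suc n) = alternatingWalk q p (p a) n

origin : V
origin = ⟨ O , O , O , O ⟩

alternatingCycle : Fin 4 → Fin 4 → Fin 16 → V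
alternatingCycle i j k = alternatingWalk (partner i) (partner j) origin (toℕ k)

union-adjacent : ∀ i j u v → Union i j u v → Q4Adj u v
union-adjacent i j u _ (inj₁ refl) = ∣symDiff-flip∣ (lookup (directions u) i) u
union-adjacent i j u _ (inj₂ refl) = ∣symDiff-flip∣ (lookup (directions u) j) u

hub-traced : ∀ j → Traces (Union zero (suc j)) (alternatingCycle zero (suc j))
hub-traced = from-yes (all? λ j → traces? (union? zero (suc j)) (alternatingCycle zero (suc j)))

hub-hamiltonian : ∀ j → IsHamiltonCycle (Union zero (suc j))
hub-hamiltonian j = union-adjacent zero (suc j) , alternatingCycle zero (suc j) , hub-traced j

component : Fin 4 → Fin 4 → V → Bool
component i j u = does (any? λ k → alternatingCycle i j k ≟ᵛ u)

leaves-split : ∀ i j → i ≢ j → Splits (suc i) (suc j) (component (suc i) (suc j))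
leaves-split = from-yes (all? λ i → all? λ j → ¬? (i ≟ᶠ j) →-dec splits? (suc i) (suc j))
  where
  splits? : ∀ i j → Dec (Splits i j (component i j))
  splits? i j = (allSubset? λ u → component i j (partner i u) ≟ᵇ component i j u)
         ×-dec (allSubset? λ u → component i j (partner j u) ≟ᵇ component i j u)
         ×-dec anySubset? (λ a → component i j a ≟ᵇ true)
         ×-dec anySubset? (λ b → component i j b ≟ᵇ false)

leaves-not-hamiltonian : ∀ i j → i ≢ j → ¬ IsHamiltonCycle (Union (suc i) (suc j))
leaves-not-hamiltonian i j i≢j =
  split-union-not-hamiltonian (suc i) (suc j) (component (suc i) (suc j)) (leaves-split i j i≢j)

star : Fin 4 ⤖ K31
star = ↔⇒⤖ (mk↔ₛ′ toK31 fromK31 (λ { (inj₁ i) → refl ; (inj₂ zero) → refl })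
                               (λ { zero → refl ; (suc i) → refl }))
  where
  toK31 : Fin 4 → K31
  toK31 zero = inj₂ zero
  toK31 (suc i) = inj₁ i
  fromK31 : K31 → Fin 4
  fromK31 (inj₁ i) = suc i
  fromK31 (inj₂ zero) = zero

star-adjacency : ∀ i j → GAdj M i j ⇔ K31Adj (Bijection.to star i) (Bijection.to star j)
star-adjacency zero zero = mk⇔ (λ g → proj₁ g refl) λ ()
star-adjacency zero (suc j) = mk⇔ (const tt) (const ((λ ()) , hub-hamiltonian j))
star-adjacency (suc i) zero =
  mk⇔ (const tt) (const ((λ ()) , hamiltonian-resp (λ _ _ → mk⇔ swap swap) (hub-hamiltonian i)))
star-adjacency (suc i) (suc j) with i ≟ᶠ j
... | yes refl = mk⇔ (λ g → proj₁ g refl) λ ()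
... | no i≢j = mk⇔ (λ g → leaves-not-hamiltonian i j i≢j (proj₂ g)) λ ()

proposition7 : Σ ℕ λ m → Σ (Fin m → Subgraph) λ M → IsOneFactorization M ×
    Σ (Fin m ⤖ K31) λ f → ∀ i j → GAdj M i j ⇔ K31Adj (Bijection.to f i) (Bijection.to f j)
proposition7 = 4 , M , M-factorization , star , star-adjacency
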